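{- Suppose $G=(U,\alpha)$ and $H=(V,\beta)$ are two connected graphs, with marginals $p$ and $q$. Then any weight function $\gamma$ on $U\times V$ that satisfies the transition coupling condition (for all $u,u'\in U$, $v,v'\in V$: $p(u)\sum_{\tilde v\in V}\gamma((u,v),(u',\tilde v))=\alpha(u,u')r_\gamma(u,v)$ and $q(v)\sum_{\tilde u\in U}\gamma((u,v),(\tilde u,v'))=\beta(v,v')r_\gamma(u,v)$) also satisfies the marginal coupling condition: $\sum_{v}r_\gamma(u,v)=p(u)$ for all $u$ and $\sum_u r_\gamma(u,v)=q(v)$ for all $v$.
   Context: A weight function on a finite set $U$ is $\alpha:U\times U\to\mathbb{R}$ with $\alpha\ge0$, symmetric, $\sum_{u,u'}\alpha(u,u')=1$; marginal $p(u)=\sum_{u'}\alpha(u,u')$. A graph $G=(U,\alpha)$ (labels ignored) is connected if for any distinct $u,u'$ there are $u=u_0,\dots,u_n=u'$ with $\alpha(u_k,u_{k+1})>0$. For a weight function $\gamma$ on $U\times V$, $r_\gamma(u,v)=\sum_{u',v'}\gamma((u,v),(u',v'))$. -}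

module Defs where

open import Level using (0ℓ)
open import Algebra.Bundles using (CommutativeRing)
open import Relation.Binary.Structures using (IsTotalOrder)
open import Relation.Nullary using (¬_)
open import Relation.Binary.PropositionalEquality using (_≡_)
open import Data.Nat using (ℕ; zero; suc)
open import Data.Fin using (Fin; zero; suc; inject₁; fromℕ)
open import Data.Product using (Σ; _×_; _,_; ∃-syntax)

-- An ordered field (the paper works over ℝ, which agda-stdlib lacks;
-- we state the result for every ordered field, ℝ being one instance).
record OrderedField : Set₁ where
  field
    commRing : CommutativeRing 0ℓ 0ℓ
  open CommutativeRing commRing public hiding (zero)
  field
    _≤_          : Carrier → Carrier → Set
    isTotalOrder : IsTotalOrder _≈_ _≤_
    +-monoʳ-≤    : ∀ {x y} z → x ≤ y → (x + z) ≤ (y + z)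
    *-nonneg     : ∀ {x y} → 0# ≤ x → 0# ≤ y → 0# ≤ (x * y)
    0≉1          : ¬ (0# ≈ 1#)
    _⁻¹          : (x : Carrier) → {¬ (x ≈ 0#)} → Carrier
    ⁻¹-inverse   : ∀ x (nz : ¬ (x ≈ 0#)) → (x * (_⁻¹ x {nz})) ≈ 1#

  _<_ : Carrier → Carrier → Set
  x < y = (x ≤ y) × ¬ (x ≈ y)

module _ (F : OrderedField) where
  open OrderedField F

  Σ[_] : (n : ℕ) → (Fin n → Carrier) → Carrier
  Σ[ zero ]  f = 0#
  Σ[ suc n ] f = f zero + Σ[ n ] (λ i → f (suc i))

  record IsWeight (n : ℕ) (α : Fin n → Fin n → Carrier) : Set where
    field
      nonneg    : ∀ u u' → 0# ≤ α u u'
      symmetric : ∀ u u' → α u u' ≈ α u' u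
      total     : Σ[ n ] (λ u → Σ[ n ] (λ u' → α u u')) ≈ 1#

  marginal : (n : ℕ) → (Fin n → Fin n → Carrier) → Fin n → Carrier
  marginal n α u = Σ[ n ] (λ u' → α u u')

  Connected : (n : ℕ) → (Fin n → Fin n → Carrier) → Set
  Connected n α =
    ∀ (u u' : Fin n) → ¬ (u ≡ u') →
      Σ ℕ λ k → Σ (Fin (suc k) → Fin n) λ w → ((w zero ≡ u) × (w (fromℕ k) ≡ u')
        × (∀ (i : Fin k) → 0# < α (w (inject₁ i)) (w (suc i))))

  record IsWeight× (m n : ℕ) (γ : Fin m × Fin n → Fin m × Fin n → Carrier) : Set where
    field
      nonneg    : ∀ x y → 0# ≤ γ x y
      symmetric : ∀ x y → γ x y ≈ γ y x
      total     : Σ[ m ] (λ u → Σ[ n ] (λ v → Σ[ m ] (λ u' → Σ[ n ] (λ v' →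
                    γ (u , v) (u' , v'))))) ≈ 1#

  r : (m n : ℕ) → (Fin m × Fin n → Fin m × Fin n → Carrier) → Fin m → Fin n → Carrier
  r m n γ u v = Σ[ m ] (λ u' → Σ[ n ] (λ v' → γ (u , v) (u' , v')))

-- Summing the transition condition over v gives p(u) M(u,u') = α(u,u') R(u), where
-- R(u) = Σ_v r_γ(u,v) and M(u,u') = Σ_{v,ṽ} γ((u,v),(u',ṽ)) is symmetric.  Along an
-- edge α(u,u') > 0, comparing this identity with its transpose gives the detailed
-- balance R(u) p(u') = R(u') p(u); both endpoints of an edge have p > 0, so the
-- relation chains along paths and, by connectedness, holds for all u, u'.  Summing
-- over u' and using Σ p = Σ R = 1 yields R = p.  The same argument applies to H.
module Submission where

open import Defs
open import Data.Fin using (Fin; zero; suc; inject₁; fromℕ; _≟_)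
open import Data.Product using (_×_; _,_)
open import Data.Nat using (ℕ)
open import Relation.Nullary using (¬_; yes; no)
open import Relation.Binary.PropositionalEquality using (_≡_)
import Relation.Binary.PropositionalEquality as ≡
open import Relation.Binary.Structures using (IsTotalOrder)
import Algebra.Properties.Semiring.Sum as SemiringSum
import Algebra.Solver.CommutativeMonoid as CommutativeMonoidSolver
import Relation.Binary.Reasoning.Setoid as SetoidReasoning

module Coupling (F : OrderedField) where
  open OrderedField F
  open SetoidReasoning setoid
  open module ∑ = SemiringSum semiring using (sum)
  open CommutativeMonoidSolver *-commutativeMonoid using (solve; _⊕_; _⊜_)
  private module ≤ = IsTotalOrder isTotalOrder

  Σ≡sum : ∀ k (f : Fin k → Carrier) → Σ[_] F k f ≡ sum f
  Σ≡sum ℕ.zero    f = ≡.refl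
  Σ≡sum (ℕ.suc k) f = ≡.cong (f zero +_) (Σ≡sum k (λ i → f (suc i)))

  Σ-cong : ∀ k {f g : Fin k → Carrier} → (∀ i → f i ≈ g i) → Σ[_] F k f ≈ Σ[_] F k g
  Σ-cong k {f} {g} f≈g = begin
    Σ[_] F k f  ≡⟨ Σ≡sum k f ⟩
    sum f       ≈⟨ ∑.sum-cong-≋ f≈g ⟩
    sum g       ≡⟨ Σ≡sum k g ⟨
    Σ[_] F k g  ∎

  *-distribˡ-Σ : ∀ k c (f : Fin k → Carrier) → c * Σ[_] F k f ≈ Σ[_] F k (λ i → c * f i)
  *-distribˡ-Σ k c f = begin
    c * Σ[_] F k f             ≡⟨ ≡.cong (c *_) (Σ≡sum k f) ⟩
    c * sum f                  ≈⟨ ∑.*-distribˡ-sum c f ⟩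
    sum (λ i → c * f i)        ≡⟨ Σ≡sum k _ ⟨
    Σ[_] F k (λ i → c * f i)   ∎

  *-distribʳ-Σ : ∀ k c (f : Fin k → Carrier) → Σ[_] F k f * c ≈ Σ[_] F k (λ i → f i * c)
  *-distribʳ-Σ k c f = begin
    Σ[_] F k f * c             ≡⟨ ≡.cong (_* c) (Σ≡sum k f) ⟩
    sum f * c                  ≈⟨ ∑.*-distribʳ-sum c f ⟩
    sum (λ i → f i * c)        ≡⟨ Σ≡sum k _ ⟨
    Σ[_] F k (λ i → f i * c)   ∎

  Σ-comm : ∀ k l (f : Fin k → Fin l → Carrier) →
    Σ[_] F k (λ i → Σ[_] F l (f i)) ≈ Σ[_] F l (λ j → Σ[_] F k (λ i → f i j))
  Σ-comm k l f = begin
    Σ[_] F k (λ i → Σ[_] F l (f i))            ≡⟨ Σ≡sum k _ ⟩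
    sum (λ i → Σ[_] F l (f i))                 ≈⟨ ∑.sum-cong-≋ (λ i → reflexive (Σ≡sum l (f i))) ⟩
    sum (λ i → sum (f i))                      ≈⟨ ∑.∑-comm f ⟩
    sum (λ j → sum (λ i → f i j))              ≈⟨ ∑.sum-cong-≋ (λ j → reflexive (Σ≡sum k (λ i → f i j))) ⟨
    sum (λ j → Σ[_] F k (λ i → f i j))         ≡⟨ Σ≡sum l _ ⟨
    Σ[_] F l (λ j → Σ[_] F k (λ i → f i j))    ∎

  Σ²-transpose : ∀ k l (f g : Fin k → Fin l → Carrier) → (∀ i j → f i j ≈ g i j) →
    Σ[_] F k (λ i → Σ[_] F l (f i)) ≈ Σ[_] F l (λ j → Σ[_] F k (λ i → g i j))
  Σ²-transpose k l f g f≈g = trans (Σ-cong k (λ i → Σ-cong l (f≈g i))) (Σ-comm k l g)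

  0≤+ : ∀ {x y} → 0# ≤ x → 0# ≤ y → 0# ≤ (x + y)
  0≤+ {x} {y} 0≤x 0≤y = ≤.trans (≤.reflexive (sym (+-identityʳ 0#)))
    (≤.trans (+-monoʳ-≤ 0# 0≤x) (≤.trans (≤.reflexive (+-comm x 0#))
    (≤.trans (+-monoʳ-≤ x 0≤y) (≤.reflexive (+-comm y x)))))

  x≤x+y : ∀ x {y} → 0# ≤ y → x ≤ (x + y)
  x≤x+y x {y} 0≤y = ≤.trans (≤.reflexive (sym (+-identityˡ x)))
    (≤.trans (+-monoʳ-≤ x 0≤y) (≤.reflexive (+-comm y x)))

  0≤Σ : ∀ k (f : Fin k → Carrier) → (∀ i → 0# ≤ f i) → 0# ≤ Σ[_] F k f
  0≤Σ ℕ.zero    f 0≤f = ≤.reflexive refl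
  0≤Σ (ℕ.suc k) f 0≤f = 0≤+ (0≤f zero) (0≤Σ k _ (λ i → 0≤f (suc i)))

  term≤Σ : ∀ k (f : Fin k → Carrier) → (∀ i → 0# ≤ f i) → ∀ i → f i ≤ Σ[_] F k f
  term≤Σ (ℕ.suc k) f 0≤f zero    = x≤x+y (f zero) (0≤Σ k _ (λ i → 0≤f (suc i)))
  term≤Σ (ℕ.suc k) f 0≤f (suc i) = ≤.trans (term≤Σ k _ (λ j → 0≤f (suc j)) i)
    (≤.trans (≤.reflexive (sym (+-identityˡ _))) (+-monoʳ-≤ _ (0≤f zero)))

  Σ≉0 : ∀ k (f : Fin k → Carrier) → (∀ i → 0# ≤ f i) → ∀ i → 0# < f i → ¬ (Σ[_] F k f ≈ 0#)
  Σ≉0 k f 0≤f i (_ , 0≉fi) Σf≈0 =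
    0≉fi (≤.antisym (0≤f i) (≤.trans (term≤Σ k f 0≤f i) (≤.reflexive Σf≈0)))

  *-cancelʳ : ∀ {a x y} → ¬ (a ≈ 0#) → x * a ≈ y * a → x ≈ y
  *-cancelʳ {a} {x} {y} a≉0 xa≈ya = begin
    x                ≈⟨ *-identityʳ x ⟨
    x * 1#           ≈⟨ *-congˡ (⁻¹-inverse a a≉0) ⟨
    x * (a * a⁻¹)    ≈⟨ *-assoc x a a⁻¹ ⟨
    x * a * a⁻¹      ≈⟨ *-congʳ xa≈ya ⟩
    y * a * a⁻¹      ≈⟨ *-assoc y a a⁻¹ ⟩
    y * (a * a⁻¹)    ≈⟨ *-congˡ (⁻¹-inverse a a≉0) ⟩
    y * 1#           ≈⟨ *-identityʳ y ⟩
    y                ∎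
    where a⁻¹ = _⁻¹ a {a≉0}

  module DetailedBalance
    {m : ℕ} {α : Fin m → Fin m → Carrier} (α-weight : IsWeight F m α) (α-connected : Connected F m α)
    (M : Fin m → Fin m → Carrier) (M-sym : ∀ a b → M a b ≈ M b a)
    (R : Fin m → Carrier) (transition : ∀ a b → marginal F m α a * M a b ≈ α a b * R a)
    where
    open IsWeight α-weight

    p : Fin m → Carrier
    p = marginal F m α

    Balanced : Fin m → Fin m → Set
    Balanced a b = R a * p b ≈ R b * p a

    edge⇒p≉0 : ∀ {a b} → 0# < α a b → ¬ (p b ≈ 0#)
    edge⇒p≉0 {a} {b} (0≤α , 0≉α) =
      Σ≉0 m (α b) (nonneg b) a (≤.trans 0≤α (≤.reflexive (symmetric a b)) , λ 0≈α → 0≉α (trans 0≈α (symmetric b a)))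

    edge⇒balanced : ∀ a b → 0# < α a b → Balanced a b
    edge⇒balanced a b (_ , 0≉α) = *-cancelʳ (λ α≈0 → 0≉α (sym α≈0)) (begin
      R a * p b * α a b    ≈⟨ solve 3 (λ x y z → (x ⊕ y) ⊕ z ⊜ (z ⊕ x) ⊕ y) refl (R a) (p b) (α a b) ⟩
      α a b * R a * p b    ≈⟨ *-congʳ (transition a b) ⟨
      p a * M a b * p b    ≈⟨ *-congʳ (*-congˡ (M-sym a b)) ⟩
      p a * M b a * p b    ≈⟨ solve 3 (λ x y z → (x ⊕ y) ⊕ z ⊜ (z ⊕ y) ⊕ x) refl (p a) (M b a) (p b) ⟩
      p b * M b a * p a    ≈⟨ *-congʳ (transition b a) ⟩
      α b a * R b * p a    ≈⟨ *-congʳ (*-congʳ (symmetric b a)) ⟩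
      α a b * R b * p a    ≈⟨ solve 3 (λ x y z → (x ⊕ y) ⊕ z ⊜ (y ⊕ z) ⊕ x) refl (α a b) (R b) (p a) ⟩
      R b * p a * α a b    ∎)

    balanced-trans : ∀ {a b c} → ¬ (p b ≈ 0#) → Balanced a b → Balanced b c → Balanced a c
    balanced-trans {a} {b} {c} pb≉0 ab bc = *-cancelʳ pb≉0 (begin
      R a * p c * p b    ≈⟨ solve 3 (λ x y z → (x ⊕ y) ⊕ z ⊜ (x ⊕ z) ⊕ y) refl (R a) (p c) (p b) ⟩
      R a * p b * p c    ≈⟨ *-congʳ ab ⟩
      R b * p a * p c    ≈⟨ solve 3 (λ x y z → (x ⊕ y) ⊕ z ⊜ (x ⊕ z) ⊕ y) refl (R b) (p a) (p c) ⟩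
      R b * p c * p a    ≈⟨ *-congʳ bc ⟩
      R c * p b * p a    ≈⟨ solve 3 (λ x y z → (x ⊕ y) ⊕ z ⊜ (x ⊕ z) ⊕ y) refl (R c) (p b) (p a) ⟩
      R c * p a * p b    ∎)

    path⇒balanced : ∀ k (w : Fin (ℕ.suc k) → Fin m) →
      (∀ i → 0# < α (w (inject₁ i)) (w (suc i))) → Balanced (w zero) (w (fromℕ k))
    path⇒balanced ℕ.zero    w edges = refl
    path⇒balanced (ℕ.suc k) w edges = balanced-trans (edge⇒p≉0 (edges zero))
      (edge⇒balanced _ _ (edges zero)) (path⇒balanced k (λ i → w (suc i)) (λ i → edges (suc i)))

    balanced : ∀ a b → Balanced a b
    balanced a b with a ≟ b
    ... | yes ≡.refl = refl
    ... | no a≢b with α-connected a b a≢b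
    ... | k , w , ≡.refl , ≡.refl , edges = path⇒balanced k w edges

    R≈marginal : Σ[_] F m R ≈ 1# → ∀ a → R a ≈ p a
    R≈marginal ΣR≈1 a = begin
      R a                         ≈⟨ *-identityʳ (R a) ⟨
      R a * 1#                    ≈⟨ *-congˡ total ⟨
      R a * Σ[_] F m p            ≈⟨ *-distribˡ-Σ m (R a) p ⟩
      Σ[_] F m (λ b → R a * p b)  ≈⟨ Σ-cong m (balanced a) ⟩
      Σ[_] F m (λ b → R b * p a)  ≈⟨ *-distribʳ-Σ m (p a) R ⟨
      Σ[_] F m R * p a            ≈⟨ *-congʳ ΣR≈1 ⟩
      1# * p a                    ≈⟨ *-identityˡ (p a) ⟩
      p a                         ∎

proposition6p1 : (F : OrderedField) → let open OrderedField F in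
    (m n : ℕ) →
    (α : Fin m → Fin m → Carrier) (β : Fin n → Fin n → Carrier)
    (γ : Fin m × Fin n → Fin m × Fin n → Carrier) →
    IsWeight F m α → IsWeight F n β → IsWeight× F m n γ →
    Connected F m α → Connected F n β →
    (∀ (u u' : Fin m) (v v' : Fin n) →
      (marginal F m α u * Σ[_] F n (λ ṽ → γ (u , v) (u' , ṽ)))
        ≈ (α u u' * r F m n γ u v)) →
    (∀ (u u' : Fin m) (v v' : Fin n) →
      (marginal F n β v * Σ[_] F m (λ ũ → γ (u , v) (ũ , v')))
        ≈ (β v v' * r F m n γ u v)) →
    (∀ (u : Fin m) → Σ[_] F n (λ v → r F m n γ u v) ≈ marginal F m α u)
      × (∀ (v : Fin n) → Σ[_] F m (λ u → r F m n γ u v) ≈ marginal F n β v)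
proposition6p1 F m n α β γ α-weight β-weight γ-weight α-connected β-connected transitionˡ transitionʳ =
  DetailedBalance.R≈marginal α-weight α-connected Mˡ Mˡ-sym Rˡ summedˡ γ-total ,
  DetailedBalance.R≈marginal β-weight β-connected Mʳ Mʳ-sym Rʳ summedʳ (trans (sym (Σ-comm m n (r F m n γ))) γ-total)
  where
    open OrderedField F
    open Coupling F
    open IsWeight× γ-weight renaming (symmetric to γ-sym; total to γ-total)

    Mˡ : Fin m → Fin m → Carrier
    Mˡ a b = Σ[_] F n (λ v → Σ[_] F n (λ ṽ → γ (a , v) (b , ṽ)))
    Mʳ : Fin n → Fin n → Carrier
    Mʳ c d = Σ[_] F m (λ u → Σ[_] F m (λ ũ → γ (u , c) (ũ , d)))
    Rˡ : Fin m → Carrier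
    Rˡ u = Σ[_] F n (r F m n γ u)
    Rʳ : Fin n → Carrier
    Rʳ v = Σ[_] F m (λ u → r F m n γ u v)

    Mˡ-sym : ∀ a b → Mˡ a b ≈ Mˡ b a
    Mˡ-sym a b = Σ²-transpose n n _ _ (λ v ṽ → γ-sym (a , v) (b , ṽ))
    Mʳ-sym : ∀ c d → Mʳ c d ≈ Mʳ d c
    Mʳ-sym c d = Σ²-transpose m m _ _ (λ u ũ → γ-sym (u , c) (ũ , d))

    -- The hypotheses quantify over a v' (resp. u') that does not occur in them.
    summedˡ : ∀ a b → marginal F m α a * Mˡ a b ≈ α a b * Rˡ a
    summedˡ a b = trans (*-distribˡ-Σ n _ _)
      (trans (Σ-cong n (λ v → transitionˡ a b v v)) (sym (*-distribˡ-Σ n _ _)))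
    summedʳ : ∀ c d → marginal F n β c * Mʳ c d ≈ β c d * Rʳ c
    summedʳ c d = trans (*-distribˡ-Σ m _ _)
      (trans (Σ-cong m (λ u → transitionʳ u u c d)) (sym (*-distribˡ-Σ m _ _)))
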